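{- Let $F$ be a number field or a finite extension of $\mathbb{Q}_p$, and let $\psi\in\mathbb{Z}\hat G$. Then $\Theta_*(\psi)\in\mathbb{Z}G$ if and only if $\psi\in A_{\hat G}$.
   Context: $G$ is a finite abelian group of odd order. Fix for each $n\ge1$ a primitive $n$-th root of unity $\zeta_n\in F^c$. $\hat G=\mathrm{Hom}(G,(F^c)^\times)$ and $A_{\hat G}=\{\sum n_\chi\chi\in\mathbb{Z}\hat G:\prod_\chi\chi^{n_\chi}=1\}$. For $\chi\in\hat G$, $s\in G$, $\upsilon(\chi,s)$ is the unique integer in $[\frac{1-|s|}2,\frac{|s|-1}2]$ with $\chi(s)=\zeta_{|s|}^{\upsilon(\chi,s)}$, and $\langle\chi,s\rangle_*=\upsilon(\chi,s)/|s|$, extended $\mathbb{Q}$-linearly to $\mathbb{Q}\hat G\times\mathbb{Q}G$. $\Theta_*:\mathbb{Q}\hat G\to\mathbb{Q}G$, $\Theta_*(\psi)=\sum_{s\in G}\langle\psi,s\rangle_*s$. -}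

module Defs where

open import Level using (Level; _⊔_)
open import Algebra.Bundles using (CommutativeRing; AbelianGroup)
open import Data.Nat as ℕ using (ℕ; zero; suc)
open import Data.Integer as ℤ using (ℤ; +_; -[1+_])
open import Data.Rational as ℚ using (ℚ)
open import Data.List using (List; []; _∷_; _++_; length)
open import Data.List.Relation.Unary.Any using (Any)
open import Data.List.Relation.Unary.AllPairs using (AllPairs)
open import Data.Product using (_×_; _,_; Σ; ∃)
open import Relation.Nullary using (¬_)
open import Relation.Binary.PropositionalEquality using (_≡_)

-- The field F^c : an algebraically closed field of characteristic 0,
-- given as a commutative ring satisfying the field axioms.

module _ {c ℓ : Level} (K : CommutativeRing c ℓ) where
  open CommutativeRing K

  kpow : Carrier → ℕ → Carrier
  kpow x zero = 1#
  kpow x (suc n) = x * kpow x n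

  natK : ℕ → Carrier
  natK zero = 0#
  natK (suc n) = 1# + natK n

  -- Horner evaluation of the polynomial with coefficient list
  -- c₀ ∷ c₁ ∷ … (constant term first)
  evalPoly : List Carrier → Carrier → Carrier
  evalPoly [] x = 0#
  evalPoly (a ∷ as) x = a + x * evalPoly as x

  IsField : Set (c ⊔ ℓ)
  IsField = (¬ (1# ≈ 0#)) ×
            (∀ x → ¬ (x ≈ 0#) → Σ Carrier λ y → x * y ≈ 1#)

  CharZero : Set ℓ
  CharZero = ∀ n → ¬ (natK (suc n) ≈ 0#)

  -- every monic polynomial  c₀ + c₁ x + … + c_{d-1} x^{d-1} + x^d
  -- of degree d = length cs ≥ 1 has a root
  AlgClosed : Set (c ⊔ ℓ)
  AlgClosed = ∀ (a : Carrier) (cs : List Carrier) →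
              Σ Carrier λ x → evalPoly (a ∷ cs ++ (1# ∷ [])) x ≈ 0#

  PrimitiveRoots : (ℕ → Carrier) → Set ℓ
  PrimitiveRoots ζ = ∀ n → 0 ℕ.< n →
    (kpow (ζ n) n ≈ 1#) × (∀ m → 0 ℕ.< m → m ℕ.< n → ¬ (kpow (ζ n) m ≈ 1#))

module _ {a b : Level} (G : AbelianGroup a b) where
  open AbelianGroup G

  gpow : Carrier → ℕ → Carrier
  gpow x zero = ε
  gpow x (suc n) = x ∙ gpow x n

  IsOrder : Carrier → ℕ → Set b
  IsOrder s n = (0 ℕ.< n) × (gpow s n ≈ ε) ×
                (∀ m → 0 ℕ.< m → m ℕ.< n → ¬ (gpow s m ≈ ε))

  -- `es` lists every element of G exactly once (so |G| = length es)
  Enumerates : List Carrier → Set (a ⊔ b)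
  Enumerates es = (∀ x → Any (x ≈_) es) × AllPairs (λ x y → ¬ (x ≈ y)) es

module _ {c ℓ a b : Level} (K : CommutativeRing c ℓ) (G : AbelianGroup a b) where
  private
    module K = CommutativeRing K
    module G = AbelianGroup G

  record Character : Set (c ⊔ ℓ ⊔ a ⊔ b) where
    field
      χ    : G.Carrier → K.Carrier
      cong : ∀ {x y} → x G.≈ y → χ x K.≈ χ y
      hom  : ∀ x y → χ (x G.∙ y) K.≈ χ x K.* χ y
      unit : χ G.ε K.≈ K.1#

  open Character

  -- An element ψ = Σ n_χ χ of ℤĜ, written as a finite formal sum
  -- (list of pairs (n_χ , χ)).
  ZĜ : Set (c ⊔ ℓ ⊔ a ⊔ b)
  ZĜ = List (ℤ × Character)

  -- x ≈ ζ ^ v  for v ∈ ℤ (for v < 0 : x * ζ^{-v} ≈ 1)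
  ZPowEq : K.Carrier → K.Carrier → ℤ → Set ℓ
  ZPowEq x z (+ k)    = x K.≈ kpow K z k
  ZPowEq x z -[1+ k ] = x K.* kpow K z (suc k) K.≈ K.1#

  -- v = υ(χ , s), where n = |s| :  (1-n)/2 ≤ v ≤ (n-1)/2  and  χ(s) = ζ_n^v
  IsUpsilon : (ℕ → K.Carrier) → Character → G.Carrier → ℕ → ℤ → Set ℓ
  IsUpsilon ζ ch s n v =
    (ℤ.+ 1 ℤ.- ℤ.+ n ℤ.≤ ℤ.+ 2 ℤ.* v) ×
    (ℤ.+ 2 ℤ.* v ℤ.≤ ℤ.+ n ℤ.- ℤ.+ 1) ×
    ZPowEq (χ ch s) (ζ n) v

  Upsilons : (ℕ → K.Carrier) → ZĜ → G.Carrier → ℕ → List ℤ → Set ℓ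
  Upsilons ζ [] s n [] = Level.Lift ℓ Data.Unit.⊤
    where import Data.Unit
  Upsilons ζ (_ ∷ _) s n [] = Level.Lift ℓ Data.Empty.⊥
    where import Data.Empty
  Upsilons ζ [] s n (_ ∷ _) = Level.Lift ℓ Data.Empty.⊥
    where import Data.Empty
  Upsilons ζ ((_ , ch) ∷ ψ) s n (v ∷ vs) =
    IsUpsilon ζ ch s n v × Upsilons ζ ψ s n vs

  -- coefficient of s in Θ_*(ψ) = Σ_i n_i ⟨χ_i , s⟩_* = Σ_i n_i υ(χ_i,s)/|s|,
  -- given vs = (υ(χ_i , s))_i and |s| = suc m
  thetaCoeff : ZĜ → List ℤ → ℕ → ℚ
  thetaCoeff ((n , _) ∷ ψ) (v ∷ vs) m =
    (n ℚ./ 1) ℚ.* (v ℚ./ suc m) ℚ.+ thetaCoeff ψ vs m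
  thetaCoeff _ _ m = ℚ.0ℚ

  IsIntegerℚ : ℚ → Set
  IsIntegerℚ q = ℚ.denominatorℕ q ≡ 1

  ThetaIntegral : (ℕ → K.Carrier) → ZĜ → Set (a ⊔ b ⊔ ℓ)
  ThetaIntegral ζ ψ = ∀ (s : G.Carrier) (m : ℕ) → IsOrder G s (suc m) →
    ∀ (vs : List ℤ) → Upsilons ζ ψ s (suc m) vs → IsIntegerℚ (thetaCoeff ψ vs m)

  posPart : ZĜ → G.Carrier → K.Carrier
  posPart [] g = K.1#
  posPart ((+ k , ch) ∷ ψ) g = kpow K (χ ch g) k K.* posPart ψ g
  posPart ((-[1+ k ] , ch) ∷ ψ) g = posPart ψ g

  negPart : ZĜ → G.Carrier → K.Carrier
  negPart [] g = K.1#
  negPart ((+ k , ch) ∷ ψ) g = negPart ψ g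
  negPart ((-[1+ k ] , ch) ∷ ψ) g = kpow K (χ ch g) (suc k) K.* negPart ψ g

  -- ψ ∈ A_Ĝ :  Π_χ χ^{n_χ} = 1 (trivial character), i.e. for every g,
  -- Π_{n_χ>0} χ(g)^{n_χ} = Π_{n_χ<0} χ(g)^{-n_χ}
  InA : ZĜ → Set (a ⊔ ℓ)
  InA ψ = ∀ (g : G.Carrier) → posPart ψ g K.≈ negPart ψ g

-- Let s ∈ G have order n and write χ(s) = ζₙ^υ(χ,s). The coefficient of s in Θ_*(ψ) is
-- (Σ n_χ υ(χ,s)) / n, while (Π χ^n_χ)(s) = ζₙ^(Σ n_χ υ(χ,s)). As ζₙ is primitive, the
-- coefficient is an integer exactly when (Π χ^n_χ)(s) = 1, so Θ_*(ψ) ∈ ℤG iff ψ ∈ A_Ĝ.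
-- Since |G| is odd, so is n, and every residue mod n has a representative in the range
-- [(1-n)/2, (n-1)/2] in which υ is taken.
--
-- Equality in F^c is not decidable, so the exponents υ(χ,s) only exist up to double
-- negation, and ψ ∈ A_Ĝ is first obtained doubly negated. Both gaps are closed by the
-- orthogonality relation Σ_{t<n} Σ_{i<n} (u ζₙ^t)^i = n, valid for every n-th root of
-- unity u, together with n ≠ 0 in characteristic 0.

module Submission where

open import Level using (Level; lift)
open import Algebra.Bundles using (Monoid; CommutativeRing; AbelianGroup)
open import Data.Unit using (tt)
open import Data.Nat as ℕ using (ℕ; zero; suc; _<_; _≤_; _∸_)
import Data.Nat.Properties as ℕP
open import Data.Nat.Divisibility as ℕ∣ using (divides)
open import Data.Nat.DivMod using (_%_; _/_; m≡m%n+[m/n]*n; m%n<n)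
import Data.Nat.Tactic.RingSolver as NatSolver
open import Data.Integer as ℤ using (ℤ; +_; -[1+_])
import Data.Integer.Properties as ℤP
import Data.Integer.Divisibility.Signed as ℤ∣
open import Data.Integer.Tactic.RingSolver using (solve-∀)
import Data.Rational as ℚ
import Data.Rational.Properties as ℚP
open import Data.Rational.Unnormalised as ℚᵘ using (mkℚᵘ; *≡*)
import Data.Rational.Unnormalised.Properties as ℚᵘP
open import Data.Fin as Fin using (Fin; zero; suc; toℕ)
import Data.Fin.Properties as FinP
open import Data.Fin.Permutation using (Permutation; permutation; _⟨$⟩ʳ_)
open import Data.List using (List; []; _∷_; length; lookup)
open import Data.List.Properties using (tabulate-lookup)
open import Data.List.Relation.Unary.All using (All)
open import Data.List.Relation.Unary.All.Properties using (tabulate⁻)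
open import Data.List.Relation.Unary.AllPairs using (AllPairs; _∷_)
open import Data.List.Relation.Unary.Any as Any using ()
open import Data.List.Relation.Unary.Any.Properties using (lookup-index)
open import Data.Product using (_×_; _,_; proj₁; proj₂; ∃; ∃-syntax; ∃₂)
open import Data.Sum using (_⊎_; inj₁; inj₂)
open import Function.Base using (_∘_)
open import Function.Bundles using (_⇔_; mk⇔; Equivalence)
open import Function.Construct.Composition using (_⇔-∘_)
open import Function.Construct.Symmetry using (⇔-sym)
open import Relation.Nullary using (¬_; yes; no; contradiction)
open import Relation.Nullary.Decidable using (recompute)
import Relation.Unary as U
open import Relation.Binary.Bundles using (Setoid)
open import Relation.Binary.Definitions using (Decidable)
open import Relation.Binary.PropositionalEquality as ≡ using (_≡_)
open import Defs

pos-*-+ : ∀ a b c → + (a ℕ.* b ℕ.+ c) ≡ + a ℤ.* + b ℤ.+ + c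
pos-*-+ a b c = ≡.trans (ℤP.pos-+ (a ℕ.* b) c) (≡.cong (ℤ._+ + c) (ℤP.pos-* a b))

∣-difference⇒∣⇔∣ : ∀ {k x y} → k ℤ∣.∣ x ℤ.- y → (k ℤ∣.∣ x ⇔ k ℤ∣.∣ y)
∣-difference⇒∣⇔∣ {k} {x} {y} k∣x-y = mk⇔
  (λ k∣x → ≡.subst (k ℤ∣.∣_) (y≡x-[x-y] x y) (ℤ∣.∣m∣n⇒∣m-n k∣x k∣x-y))
  (λ k∣y → ≡.subst (k ℤ∣.∣_) (x≡[x-y]+y x y) (ℤ∣.∣m∣n⇒∣m+n k∣x-y k∣y))
  where
  y≡x-[x-y] : ∀ x y → x ℤ.- (x ℤ.- y) ≡ y
  y≡x-[x-y] = solve-∀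
  x≡[x-y]+y : ∀ x y → (x ℤ.- y) ℤ.+ y ≡ x
  x≡[x-y]+y = solve-∀

even⊎odd : ∀ n → (∃[ j ] n ≡ 2 ℕ.* j) ⊎ (∃[ j ] n ≡ suc (2 ℕ.* j))
even⊎odd zero = inj₁ (0 , ≡.refl)
even⊎odd (suc n) with even⊎odd n
... | inj₁ (j , ≡.refl) = inj₂ (j , ≡.refl)
... | inj₂ (j , ≡.refl) = inj₁ (suc j , ≡.cong suc (≡.sym (ℕP.+-suc j (j ℕ.+ 0))))

∣odd⇒odd : ∀ {n k} → n ℕ∣.∣ suc (2 ℕ.* k) → ∃[ j ] n ≡ suc (2 ℕ.* j)
∣odd⇒odd {n} {k} n∣odd with even⊎odd n
... | inj₂ n-odd = n-odd
... | inj₁ (j , ≡.refl) with ℕ∣.∣-trans (ℕ∣.m∣m*n j) n∣odd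
...   | divides q odd≡q*2 = contradiction (≡.sym (≡.trans odd≡q*2 (ℕP.*-comm q 2))) (ℕP.even≢odd q k)

least : ∀ {p} {P : U.Pred ℕ p} → U.Decidable P → ∀ {n} → P n → ∃[ k ] (P k × ∀ j → j < k → ¬ P j)
least P? pₙ with P? 0
... | yes p₀ = 0 , p₀ , λ _ ()
least P? {zero} p₀ | no ¬p₀ = contradiction p₀ ¬p₀
least P? {suc n} pₙ | no ¬p₀ with least (P? ∘ suc) pₙ
... | k , pₖ , below = suc k , pₖ , λ { zero _ → ¬p₀ ; (suc j) (ℕ.s<s j<k) → below j j<k }

All-lookup : ∀ {a p} {A : Set a} {P : U.Pred A p} {xs} → All P xs → ∀ i → P (lookup xs i)
All-lookup {P = P} {xs} pxs = tabulate⁻ (≡.subst (All P) (≡.sym (tabulate-lookup xs)) pxs)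

module _ {a ℓ} (S : Setoid a ℓ) where
  open Setoid S

  lookup-injective : ∀ {xs} → AllPairs _≉_ xs → ∀ i j → lookup xs i ≈ lookup xs j → i ≡ j
  lookup-injective (_ ∷ _) zero zero _ = ≡.refl
  lookup-injective (x≉ ∷ _) zero (suc j) x≈ = contradiction x≈ (All-lookup x≉ j)
  lookup-injective (x≉ ∷ _) (suc i) zero ≈x = contradiction (sym ≈x) (All-lookup x≉ i)
  lookup-injective (_ ∷ rest) (suc i) (suc j) eq = ≡.cong suc (lookup-injective rest i j eq)

↧ₙ∣↥⇒↧ₙ≡1 : ∀ (q : ℚ.ℚ) → ℚ.↧ₙ q ℕ∣.∣ ℤ.∣ ℚ.↥ q ∣ → ℚ.↧ₙ q ≡ 1
↧ₙ∣↥⇒↧ₙ≡1 (ℚ.mkℚ _ d coprime) d∣n = recompute (suc d ℕP.≟ 1) (coprime (d∣n , ℕ∣.∣-refl))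

/-cross-multiply : ∀ i m → ℚ.↥ (i ℚ./ suc m) ℤ.* + suc m ≡ i ℤ.* ℚ.↧ (i ℚ./ suc m)
/-cross-multiply i m = ≡.subst₂ (λ a b → a ℤ.* + suc m ≡ i ℤ.* b)
  (ℚP.↥ᵘ-toℚᵘ (i ℚ./ suc m)) (ℚP.↧ᵘ-toℚᵘ (i ℚ./ suc m))
  (ℚᵘP.drop-*≡* (ℚP.toℚᵘ-fromℚᵘ (mkℚᵘ i m)))

/-denominator≡1⇔∣ : ∀ i m → (ℚ.↧ₙ (i ℚ./ suc m) ≡ 1 ⇔ + suc m ℤ∣.∣ i)
/-denominator≡1⇔∣ i m = mk⇔ to from
  where
  q : ℚ.ℚ
  q = i ℚ./ suc m
  to : ℚ.↧ₙ q ≡ 1 → + suc m ℤ∣.∣ i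
  to d≡1 = ℤ∣.divides (ℚ.↥ q) (begin
    i                     ≡⟨ ℤP.*-identityʳ i ⟨
    i ℤ.* + 1             ≡⟨ ≡.cong (λ d → i ℤ.* + d) d≡1 ⟨
    i ℤ.* ℚ.↧ q           ≡⟨ /-cross-multiply i m ⟨
    ℚ.↥ q ℤ.* + suc m     ∎)
    where open ≡.≡-Reasoning
  from : + suc m ℤ∣.∣ i → ℚ.↧ₙ q ≡ 1
  from (ℤ∣.divides w i≡w*n) = ↧ₙ∣↥⇒↧ₙ≡1 q
    (ℕ∣.divides ℤ.∣ w ∣ (≡.trans (≡.cong ℤ.∣_∣ ↥≡w*↧) (ℤP.abs-* w (ℚ.↧ q))))
    where
    swap : ∀ w n d → w ℤ.* n ℤ.* d ≡ w ℤ.* d ℤ.* n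
    swap = solve-∀
    ↥≡w*↧ : ℚ.↥ q ≡ w ℤ.* ℚ.↧ q
    ↥≡w*↧ = ℤP.*-cancelʳ-≡ _ _ (+ suc m) (≡.trans (/-cross-multiply i m)
      (≡.trans (≡.cong (ℤ._* ℚ.↧ q) i≡w*n) (swap w (+ suc m) (ℚ.↧ q))))

mkℚᵘ-+ : ∀ a b m → mkℚᵘ a m ℚᵘ.+ mkℚᵘ b m ℚᵘ.≃ mkℚᵘ (a ℤ.+ b) m
mkℚᵘ-+ a b m = *≡* (≡.trans (rearrange a b (+ suc m))
  (≡.cong ((a ℤ.+ b) ℤ.*_) (≡.sym (ℤP.pos-* (suc m) (suc m)))))
  where
  rearrange : ∀ a b n → (a ℤ.* n ℤ.+ b ℤ.* n) ℤ.* n ≡ (a ℤ.+ b) ℤ.* (n ℤ.* n)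
  rearrange = solve-∀

mkℚᵘ-* : ∀ k v m → mkℚᵘ k 0 ℚᵘ.* mkℚᵘ v m ℚᵘ.≃ mkℚᵘ (k ℤ.* v) m
mkℚᵘ-* k v m = *≡* (≡.cong (λ d → (k ℤ.* v) ℤ.* + d) (≡.sym (ℕP.*-identityˡ (suc m))))

Centred : ℕ → ℤ → Set
Centred n v = (+ 1 ℤ.- + n ℤ.≤ + 2 ℤ.* v) × (+ 2 ℤ.* v ℤ.≤ + n ℤ.- + 1)

module _ {j : ℕ} where
  private
    1-n≡-[2j] : + 1 ℤ.- + suc (2 ℕ.* j) ≡ ℤ.- + (2 ℕ.* j)
    1-n≡-[2j] = neg-difference (+ suc (2 ℕ.* j)) (+ 1)
      where
      neg-difference : ∀ a b → b ℤ.- a ≡ ℤ.- (a ℤ.- b)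
      neg-difference = solve-∀
    2u≤2j : ∀ {u} → u ℕ.≤ j → + (2 ℕ.* u) ℤ.≤ + (2 ℕ.* j)
    2u≤2j u≤j = ℤ.+≤+ (ℕP.*-monoʳ-≤ 2 u≤j)

  -- The upper bound n - 1 computes to 2 j; only the lower bound 1 - n needs rewriting.
  Centred-+ : ∀ {u} → u ℕ.≤ j → Centred (suc (2 ℕ.* j)) (+ u)
  Centred-+ {u} u≤j =
    ≡.subst₂ ℤ._≤_ (≡.sym 1-n≡-[2j]) (ℤP.pos-* 2 u) ℤP.neg-≤-pos ,
    ≡.subst (ℤ._≤ + (2 ℕ.* j)) (ℤP.pos-* 2 u) (2u≤2j u≤j)

  Centred-- : ∀ {u} → u ℕ.≤ j → Centred (suc (2 ℕ.* j)) (ℤ.- + u)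
  Centred-- {u} u≤j =
    ≡.subst₂ ℤ._≤_ (≡.sym 1-n≡-[2j]) 2·-u (ℤP.neg-mono-≤ (2u≤2j u≤j)) ,
    ≡.subst (ℤ._≤ + (2 ℕ.* j)) 2·-u ℤP.neg-≤-pos
    where
    2·-u : ℤ.- + (2 ℕ.* u) ≡ + 2 ℤ.* ℤ.- + u
    2·-u = ≡.trans (≡.cong ℤ.-_ (ℤP.pos-* 2 u)) (ℤP.neg-distribʳ-* (+ 2) (+ u))

module MonoidOrder {a ℓ} (M : Monoid a ℓ) where
  open Monoid M
  open import Algebra.Properties.Monoid.Mult M
    using () renaming (_×_ to _·_; ×-homo-+ to ^-homo-∙; ×-assocˡ to ^-assocʳ; ×-congʳ to ^-congˡ)
  open import Relation.Binary.Reasoning.Setoid setoid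

  infixr 8 _^_
  _^_ : Carrier → ℕ → Carrier
  x ^ n = n · x

  HasOrder : Carrier → ℕ → Set ℓ
  HasOrder x n = (0 < n) × (x ^ n ≈ ε) × (∀ j → 0 < j → j < n → ¬ (x ^ j ≈ ε))

  ε^ : ∀ q → ε ^ q ≈ ε
  ε^ zero = refl
  ε^ (suc q) = trans (identityˡ _) (ε^ q)

  ∣⇒^≈ε : ∀ {x n a} → x ^ n ≈ ε → n ℕ∣.∣ a → x ^ a ≈ ε
  ∣⇒^≈ε {x} {n} xⁿ≈ε (divides q ≡.refl) =
    trans (sym (^-assocʳ x q n)) (trans (^-congˡ q xⁿ≈ε) (ε^ q))

  ^≈ε⇒∣ : ∀ {x m} a → HasOrder x (suc m) → x ^ a ≈ ε → suc m ℕ∣.∣ a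
  ^≈ε⇒∣ {x} {m} a (_ , xⁿ≈ε , minimal) xᵃ≈ε with a % suc m ℕ.≟ 0
  ... | yes r≡0 = ℕ∣.m%n≡0⇒n∣m a (suc m) r≡0
  ... | no r≢0 = contradiction xʳ≈ε (minimal r (ℕP.n≢0⇒n>0 r≢0) (m%n<n a (suc m)))
    where
    r q : ℕ
    r = a % suc m
    q = a / suc m
    xʳ≈ε : x ^ r ≈ ε
    xʳ≈ε = begin
      x ^ r                        ≈⟨ identityʳ _ ⟨
      x ^ r ∙ ε                    ≈⟨ ∙-congˡ (∣⇒^≈ε xⁿ≈ε (ℕ∣.n∣m*n q)) ⟨
      x ^ r ∙ x ^ (q ℕ.* suc m)    ≈⟨ ^-homo-∙ x r (q ℕ.* suc m) ⟨
      x ^ (r ℕ.+ q ℕ.* suc m)      ≡⟨ ≡.cong (x ^_) (m≡m%n+[m/n]*n a (suc m)) ⟨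
      x ^ a                        ≈⟨ xᵃ≈ε ⟩
      ε                            ∎

  order-exists : Decidable _≈_ → ∀ {x} k → x ^ suc k ≈ ε → ∃[ m ] HasOrder x (suc m)
  order-exists _≟_ {x} k xᵏ⁺¹≈ε with least (λ j → (x ^ suc j) ≟ ε) {k} xᵏ⁺¹≈ε
  ... | m , xᵐ⁺¹≈ε , below = m , ℕ.z<s , xᵐ⁺¹≈ε , minimal
    where
    minimal : ∀ j → 0 < j → j < suc m → ¬ x ^ j ≈ ε
    minimal (suc j) _ (ℕ.s<s j<m) = below j j<m

  ^≈^⇔^≈ε : ∀ {x m} → x ^ suc m ≈ ε → ∀ a b → (x ^ a ≈ x ^ b ⇔ x ^ (a ℕ.+ m ℕ.* b) ≈ ε)
  ^≈^⇔^≈ε {x} {m} xⁿ≈ε a b = mk⇔ to from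
    where
    xⁿᵇ≈ε : x ^ (suc m ℕ.* b) ≈ ε
    xⁿᵇ≈ε = ∣⇒^≈ε {x} {suc m} xⁿ≈ε (ℕ∣.m∣m*n b)
    to : x ^ a ≈ x ^ b → x ^ (a ℕ.+ m ℕ.* b) ≈ ε
    to xᵃ≈xᵇ = begin
      x ^ (a ℕ.+ m ℕ.* b)       ≈⟨ ^-homo-∙ x a (m ℕ.* b) ⟩
      x ^ a ∙ x ^ (m ℕ.* b)     ≈⟨ ∙-congʳ xᵃ≈xᵇ ⟩
      x ^ b ∙ x ^ (m ℕ.* b)     ≈⟨ ^-homo-∙ x b (m ℕ.* b) ⟨
      x ^ (suc m ℕ.* b)         ≈⟨ xⁿᵇ≈ε ⟩
      ε                         ∎
    from : x ^ (a ℕ.+ m ℕ.* b) ≈ ε → x ^ a ≈ x ^ b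
    from xᵃ⁺ᵐᵇ≈ε = begin
      x ^ a                           ≈⟨ identityʳ _ ⟨
      x ^ a ∙ ε                       ≈⟨ ∙-congˡ xⁿᵇ≈ε ⟨
      x ^ a ∙ x ^ (suc m ℕ.* b)       ≈⟨ ^-homo-∙ x a (suc m ℕ.* b) ⟨
      x ^ (a ℕ.+ suc m ℕ.* b)         ≡⟨ ≡.cong (x ^_) (regroup a b (m ℕ.* b)) ⟩
      x ^ (a ℕ.+ m ℕ.* b ℕ.+ b)       ≈⟨ ^-homo-∙ x (a ℕ.+ m ℕ.* b) b ⟩
      x ^ (a ℕ.+ m ℕ.* b) ∙ x ^ b     ≈⟨ ∙-congʳ xᵃ⁺ᵐᵇ≈ε ⟩
      ε ∙ x ^ b                       ≈⟨ identityˡ _ ⟩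
      x ^ b                           ∎
      where
      regroup : ∀ a b c → a ℕ.+ (b ℕ.+ c) ≡ a ℕ.+ c ℕ.+ b
      regroup = NatSolver.solve-∀

  ^≈^⇔∣ : ∀ {x m} → HasOrder x (suc m) → ∀ a b → (x ^ a ≈ x ^ b ⇔ + suc m ℤ∣.∣ + a ℤ.- + b)
  ^≈^⇔∣ {x} {m} ord@(_ , xⁿ≈ε , _) a b = mk⇔
    (λ xᵃ≈xᵇ → shift-∣⇒ (^≈ε⇒∣ (a ℕ.+ m ℕ.* b) ord (Equivalence.to reduce xᵃ≈xᵇ)))
    (λ n∣a-b → Equivalence.from reduce (∣⇒^≈ε {x} {suc m} xⁿ≈ε (shift-∣⇐ n∣a-b)))
    where
    reduce : x ^ a ≈ x ^ b ⇔ x ^ (a ℕ.+ m ℕ.* b) ≈ ε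
    reduce = ^≈^⇔^≈ε {x} {m} xⁿ≈ε a b
    shift : + (a ℕ.+ m ℕ.* b) ≡ (+ a ℤ.- + b) ℤ.+ + suc m ℤ.* + b
    shift = ≡.trans (≡.trans (ℤP.pos-+ a (m ℕ.* b)) (≡.cong (ℤ._+_ (+ a)) (ℤP.pos-* m b)))
      (≡.trans (rearrange (+ a) (+ b) (+ m))
        (≡.sym (≡.cong (λ n → (+ a ℤ.- + b) ℤ.+ n ℤ.* + b) (ℤP.pos-+ 1 m))))
      where
      rearrange : ∀ a b m → a ℤ.+ m ℤ.* b ≡ (a ℤ.- b) ℤ.+ (+ 1 ℤ.+ m) ℤ.* b
      rearrange = solve-∀
    n∣nb : + suc m ℤ∣.∣ + suc m ℤ.* + b
    n∣nb = ℤ∣.∣m⇒∣m*n (+ b) ℤ∣.∣-refl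
    shift-∣⇒ : suc m ℕ∣.∣ a ℕ.+ m ℕ.* b → + suc m ℤ∣.∣ + a ℤ.- + b
    shift-∣⇒ n∣ = ℤ∣.∣m+n∣n⇒∣m (≡.subst (+ suc m ℤ∣.∣_) shift (ℤ∣.∣ᵤ⇒∣ n∣)) n∣nb
    shift-∣⇐ : + suc m ℤ∣.∣ + a ℤ.- + b → suc m ℕ∣.∣ a ℕ.+ m ℕ.* b
    shift-∣⇐ n∣ = ℤ∣.∣⇒∣ᵤ (≡.subst (+ suc m ℤ∣.∣_) (≡.sym shift) (ℤ∣.∣m∣n⇒∣m+n n∣ n∣nb))

module FiniteAbelianGroup {a b} (G : AbelianGroup a b) {es : List (AbelianGroup.Carrier G)} (enum : Enumerates G es) where
  open AbelianGroup G
  open MonoidOrder monoid using (_^_; HasOrder; order-exists; ^≈ε⇒∣)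
  open import Algebra.Properties.CommutativeMonoid.Sum commutativeMonoid
    using (sum; sum-cong-≋; sum-permute; ∑-distrib-+; sum-replicate)
  open import Algebra.Properties.Group group using (identityˡ-unique; \\-cong₂; \\-leftDividesˡ; \\-leftDividesʳ)
  open import Relation.Binary.Reasoning.Setoid setoid

  private
    N : ℕ
    N = length es

  gpow≡^ : ∀ x n → gpow G x n ≡ x ^ n
  gpow≡^ x zero = ≡.refl
  gpow≡^ x (suc n) = ≡.cong (x ∙_) (gpow≡^ x n)

  element : Fin N → Carrier
  element = lookup es

  index : Carrier → Fin N
  index x = Any.index (proj₁ enum x)

  element-index : ∀ x → x ≈ element (index x)
  element-index x = lookup-index (proj₁ enum x)

  index-unique : ∀ {x i} → x ≈ element i → index x ≡ i
  index-unique {x} x≈eᵢ = lookup-injective setoid (proj₂ enum) _ _ (trans (sym (element-index x)) x≈eᵢ)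

  _≟_ : Decidable _≈_
  x ≟ y with index x Fin.≟ index y
  ... | yes iₓ≡iᵧ =
    yes (trans (element-index x) (trans (reflexive (≡.cong element iₓ≡iᵧ)) (sym (element-index y))))
  ... | no iₓ≢iᵧ = no (λ x≈y → iₓ≢iᵧ (index-unique (trans x≈y (element-index y))))

  translation : Carrier → Permutation N N
  translation g = permutation (λ i → index (g ∙ element i)) (λ j → index (g ⁻¹ ∙ element j))
    (λ j → index-unique (trans (∙-congˡ (sym (element-index _))) (\\-leftDividesˡ g (element j))))
    (λ i → index-unique (trans (\\-cong₂ refl (sym (element-index _))) (\\-leftDividesʳ g (element i))))

  lagrange : ∀ g → g ^ N ≈ ε
  lagrange g = identityˡ-unique (g ^ N) (sum element) (sym (begin
    sum element                                 ≈⟨ sum-permute element (translation g) ⟩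
    sum (λ i → element (translation g ⟨$⟩ʳ i))  ≈⟨ sum-cong-≋ {N} (λ i → sym (element-index _)) ⟩
    sum (λ i → g ∙ element i)                   ≈⟨ ∑-distrib-+ {N} (λ _ → g) element ⟩
    sum {N} (λ _ → g) ∙ sum element             ≈⟨ ∙-congʳ (sum-replicate N) ⟩
    g ^ N ∙ sum element                         ∎))

  HasOrder⇒IsOrder : ∀ {x n} → HasOrder x n → IsOrder G x n
  HasOrder⇒IsOrder {x} {n} (0<n , xⁿ≈ε , minimal) =
    0<n , ≡.subst (_≈ ε) (≡.sym (gpow≡^ x n)) xⁿ≈ε ,
    λ j 0<j j<n xʲ≈ε → minimal j 0<j j<n (≡.subst (_≈ ε) (gpow≡^ x j) xʲ≈ε)

  odd-order : ∀ {k} → N ≡ suc (2 ℕ.* k) → ∀ g → ∃[ j ] IsOrder G g (suc (2 ℕ.* j))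
  odd-order {k} N≡odd g with order-exists _≟_ (2 ℕ.* k) (≡.subst (λ e → g ^ e ≈ ε) N≡odd (lagrange g))
  ... | m , g-order with ∣odd⇒odd {suc m} {k} (≡.subst (suc m ℕ∣.∣_) N≡odd (^≈ε⇒∣ N g-order (lagrange g)))
  ...   | j , ≡.refl = j , HasOrder⇒IsOrder g-order

module RootsOfUnity {c ℓ} (K : CommutativeRing c ℓ) where
  open CommutativeRing K hiding (zero)
  open import Algebra.Properties.CommutativeSemiring.Exp commutativeSemiring
  open import Algebra.Properties.Semiring.Sum semiring
    using (sum-syntax; sum-cong-≋; sum-replicate-zero; sum-init-last; ∑-comm; *-distribˡ-sum)
  open import Algebra.Properties.Ring ring using ([y-z]x≈yx-zx)
  open import Algebra.Properties.Group +-group using (∙-cancelʳ; x∙y⁻¹≈ε⇒x≈y; x≈y⇒x∙y⁻¹≈ε)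
  open MonoidOrder *-monoid using (HasOrder; ε^)
  open import Algebra.Properties.CommutativeSemigroup *-commutativeSemigroup using (x∙yz≈y∙xz)
  open import Relation.Binary.Reasoning.Setoid setoid

  kpow≡^ : ∀ x n → kpow K x n ≡ x ^ n
  kpow≡^ x zero = ≡.refl
  kpow≡^ x (suc n) = ≡.cong (x *_) (kpow≡^ x n)

  ^-comm : ∀ y a b → (y ^ a) ^ b ≈ (y ^ b) ^ a
  ^-comm y a b = begin
    (y ^ a) ^ b   ≈⟨ ^-assocʳ y a b ⟩
    y ^ (a ℕ.* b) ≡⟨ ≡.cong (y ^_) (ℕP.*-comm a b) ⟩
    y ^ (b ℕ.* a) ≈⟨ ^-assocʳ y b a ⟨
    (y ^ b) ^ a   ∎

  ^-root : ∀ {y n} k → y ^ n ≈ 1# → (y ^ k) ^ n ≈ 1#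
  ^-root {y} {n} k yⁿ≈1 = trans (^-comm y k n) (trans (^-congˡ k yⁿ≈1) (ε^ k))

  *-root : ∀ {x y n} → x ^ n ≈ 1# → y ^ n ≈ 1# → (x * y) ^ n ≈ 1#
  *-root {x} {y} {n} xⁿ≈1 yⁿ≈1 =
    trans (^-distrib-* x y n) (trans (*-cong xⁿ≈1 yⁿ≈1) (*-identityˡ 1#))

  *-cancelʳ-invertible : ∀ {x w a b} → x * w ≈ 1# → a * x ≈ b * x → a ≈ b
  *-cancelʳ-invertible {x} {w} {a} {b} xw≈1 ax≈bx = begin
    a             ≈⟨ *-identityʳ a ⟨
    a * 1#        ≈⟨ *-congˡ xw≈1 ⟨
    a * (x * w)   ≈⟨ *-assoc a x w ⟨
    (a * x) * w   ≈⟨ *-congʳ ax≈bx ⟩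
    (b * x) * w   ≈⟨ *-assoc b x w ⟩
    b * (x * w)   ≈⟨ *-congˡ xw≈1 ⟩
    b * 1#        ≈⟨ *-identityʳ b ⟩
    b             ∎

  ∑-1 : ∀ n → ∑[ i < n ] 1# ≈ natK K n
  ∑-1 zero = refl
  ∑-1 (suc n) = +-congˡ (∑-1 n)

  geometricSum : Carrier → ℕ → Carrier
  geometricSum y n = ∑[ i < n ] (y ^ toℕ i)

  geometricSum-fixed : ∀ {y} n → y ^ n ≈ 1# → y * geometricSum y n ≈ geometricSum y n
  geometricSum-fixed {y} n yⁿ≈1 = ∙-cancelʳ 1# _ _ (begin
    y * G + 1#                   ≈⟨ +-comm _ _ ⟩
    1# + y * G                   ≈⟨ +-congˡ (*-distribˡ-sum {n} y (λ i → y ^ toℕ i)) ⟩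
    geometricSum y (suc n)       ≈⟨ sum-init-last {n} (λ i → y ^ toℕ i) ⟩
    ∑[ i < n ] (y ^ toℕ (Fin.inject₁ i)) + y ^ toℕ (Fin.fromℕ n)
      ≈⟨ +-cong (sum-cong-≋ {n} (λ i → reflexive (≡.cong (y ^_) (FinP.toℕ-inject₁ i))))
                (reflexive (≡.cong (y ^_) (FinP.toℕ-fromℕ n))) ⟩
    G + y ^ n                    ≈⟨ +-congˡ yⁿ≈1 ⟩
    G + 1#                       ∎)
    where
    G = geometricSum y n

  geometricSum-cong : ∀ {x y} n → x ≈ y → geometricSum x n ≈ geometricSum y n
  geometricSum-cong n x≈y = sum-cong-≋ {n} (λ i → ^-congˡ (toℕ i) x≈y)

  ∑-head : ∀ {m} (f : Fin (suc m) → Carrier) → (∀ i → f (suc i) ≈ 0#) → ∑[ i < suc m ] f i ≈ f zero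
  ∑-head {m} f tail≈0 =
    trans (+-congˡ (trans (sum-cong-≋ {m} tail≈0) (sum-replicate-zero m))) (+-identityʳ _)

  module _ (isField : IsField K) where

    fixed-by-≉1⇒≈0 : ∀ {y g} → y * g ≈ g → ¬ y ≈ 1# → g ≈ 0#
    fixed-by-≉1⇒≈0 {y} {g} yg≈g y≉1 = *-cancelʳ-invertible (proj₂ inverse) (begin
      g * (y - 1#)      ≈⟨ *-comm g _ ⟩
      (y - 1#) * g      ≈⟨ [y-z]x≈yx-zx g y 1# ⟩
      y * g - 1# * g    ≈⟨ +-cong yg≈g (-‿cong (*-identityˡ g)) ⟩
      g - g             ≈⟨ x≈y⇒x∙y⁻¹≈ε refl ⟩
      0#                ≈⟨ zeroˡ _ ⟨
      0# * (y - 1#)     ∎)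
      where
      inverse = proj₂ isField (y - 1#) (λ y-1≈0 → y≉1 (x∙y⁻¹≈ε⇒x≈y y 1# y-1≈0))

    geometricSum-vanishes : ∀ {y} n → y ^ n ≈ 1# → ¬ y ≈ 1# → geometricSum y n ≈ 0#
    geometricSum-vanishes n yⁿ≈1 = fixed-by-≉1⇒≈0 (geometricSum-fixed n yⁿ≈1)

    module Orthogonality (char0 : CharZero K) {z m} (z-order : HasOrder z (suc m)) where
      n : ℕ
      n = suc m

      twistedSum : Carrier → Carrier
      twistedSum u = ∑[ t < n ] geometricSum (u * z ^ toℕ t) n

      twisted-root : ∀ {u} → u ^ n ≈ 1# → ∀ t → (u * z ^ t) ^ n ≈ 1#
      twisted-root uⁿ≈1 t = *-root {n = n} uⁿ≈1 (^-root {z} {n} t (proj₁ (proj₂ z-order)))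

      z^≉1 : ∀ (i : Fin m) → ¬ z ^ suc (toℕ i) ≈ 1#
      z^≉1 i = proj₂ (proj₂ z-order) (suc (toℕ i)) ℕ.z<s (ℕ.s<s (FinP.toℕ<n i))

      twistedSum≈n : ∀ {u} → u ^ n ≈ 1# → twistedSum u ≈ natK K n
      twistedSum≈n {u} uⁿ≈1 = begin
        twistedSum u
          ≈⟨ ∑-comm {n} {n} (λ t i → (u * z ^ toℕ t) ^ toℕ i) ⟩
        ∑[ i < n ] ∑[ t < n ] ((u * z ^ toℕ t) ^ toℕ i)
          ≈⟨ sum-cong-≋ {n} (λ i → sum-cong-≋ {n} (λ t → separate i t)) ⟩
        ∑[ i < n ] ∑[ t < n ] (u ^ toℕ i * (z ^ toℕ i) ^ toℕ t)
          ≈⟨ sum-cong-≋ {n} (λ i → *-distribˡ-sum {n} (u ^ toℕ i) (λ t → (z ^ toℕ i) ^ toℕ t)) ⟨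
        ∑[ i < n ] (u ^ toℕ i * geometricSum (z ^ toℕ i) n)
          ≈⟨ ∑-head (λ i → u ^ toℕ i * geometricSum (z ^ toℕ i) n)
               (λ i → trans (*-congˡ (geometricSum-vanishes n (^-root {z} {n} (suc (toℕ i)) zⁿ≈1) (z^≉1 i)))
                            (zeroʳ _)) ⟩
        1# * geometricSum 1# n
          ≈⟨ *-identityˡ _ ⟩
        geometricSum 1# n
          ≈⟨ sum-cong-≋ {n} (λ i → ε^ (toℕ i)) ⟩
        ∑[ i < n ] 1#
          ≈⟨ ∑-1 n ⟩
        natK K n ∎
        where
        zⁿ≈1 : z ^ n ≈ 1#
        zⁿ≈1 = proj₁ (proj₂ z-order)
        separate : ∀ i t → (u * z ^ toℕ t) ^ toℕ i ≈ u ^ toℕ i * (z ^ toℕ i) ^ toℕ t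
        separate i t = trans (^-distrib-* u _ (toℕ i)) (*-congˡ (^-comm z (toℕ t) (toℕ i)))

      n≉0 : ¬ natK K n ≈ 0#
      n≉0 = char0 m

      ¬¬-root : ∀ {u} → u ^ n ≈ 1# → ¬ ¬ (∃[ t ] u * z ^ toℕ t ≈ 1#)
      ¬¬-root {u} uⁿ≈1 no-root = n≉0 (begin
        natK K n       ≈⟨ twistedSum≈n uⁿ≈1 ⟨
        twistedSum u   ≈⟨ sum-cong-≋ {n} (λ t → geometricSum-vanishes n (twisted-root uⁿ≈1 (toℕ t))
                                                  (λ uzᵗ≈1 → no-root (t , uzᵗ≈1))) ⟩
        ∑[ t < n ] 0#  ≈⟨ sum-replicate-zero n ⟩
        0#             ∎)

      -- A twist u z^t with 0 < t < n equal to 1 would refute u ≈ 1, so under ¬ ¬ u ≈ 1 only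
      -- the twist t = 0 contributes to twistedSum u, whence Σ u^i ≈ n is invertible.
      ¬¬-stable : ∀ {u} → u ^ n ≈ 1# → ¬ ¬ u ≈ 1# → u ≈ 1#
      ¬¬-stable {u} uⁿ≈1 ¬¬u≈1 =
        *-cancelʳ-invertible G*w≈1 (trans (geometricSum-fixed n uⁿ≈1) (sym (*-identityˡ _)))
        where
        other-twists-vanish : ∀ (t : Fin m) → geometricSum (u * z ^ suc (toℕ t)) n ≈ 0#
        other-twists-vanish t = geometricSum-vanishes n (twisted-root uⁿ≈1 (suc (toℕ t)))
          (λ uzᵗ≈1 → ¬¬u≈1 (λ u≈1 → z^≉1 t (trans (sym (*-identityˡ _)) (trans (*-congʳ (sym u≈1)) uzᵗ≈1))))
        G≈n : geometricSum u n ≈ natK K n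
        G≈n = begin
          geometricSum u n          ≈⟨ geometricSum-cong n (*-identityʳ u) ⟨
          geometricSum (u * 1#) n   ≈⟨ ∑-head (λ t → geometricSum (u * z ^ toℕ t) n) other-twists-vanish ⟨
          twistedSum u              ≈⟨ twistedSum≈n uⁿ≈1 ⟩
          natK K n                  ∎
        inverse = proj₂ isField (natK K n) n≉0
        G*w≈1 : geometricSum u n * proj₁ inverse ≈ 1#
        G*w≈1 = trans (*-congʳ G≈n) (proj₂ inverse)

      ¬¬-stable-≈ : ∀ {x y} → x ^ n ≈ 1# → y ^ n ≈ 1# → ¬ ¬ x ≈ y → x ≈ y
      ¬¬-stable-≈ {x} {y} xⁿ≈1 yⁿ≈1 ¬¬x≈y = begin
        x                 ≈⟨ *-identityʳ x ⟨
        x * 1#            ≈⟨ *-congˡ yⁿ≈1 ⟨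
        x * (y * y ^ m)   ≈⟨ x∙yz≈y∙xz x y (y ^ m) ⟩
        y * (x * y ^ m)   ≈⟨ *-congˡ (¬¬-stable (*-root {n = n} xⁿ≈1 (^-root {y} {n} m yⁿ≈1)) ¬¬xyᵐ≈1) ⟩
        y * 1#            ≈⟨ *-identityʳ y ⟩
        y                 ∎
        where
        ¬¬xyᵐ≈1 : ¬ ¬ x * y ^ m ≈ 1#
        ¬¬xyᵐ≈1 ¬xyᵐ≈1 = ¬¬x≈y (λ x≈y → ¬xyᵐ≈1 (trans (*-congʳ x≈y) yⁿ≈1))

module Theta {c ℓ a b} (K : CommutativeRing c ℓ) (G : AbelianGroup a b) where
  open CommutativeRing K hiding (zero)
  open import Algebra.Properties.CommutativeSemiring.Exp commutativeSemiring
  open MonoidOrder *-monoid using (HasOrder; ε^; ∣⇒^≈ε; ^≈^⇔∣)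
  open RootsOfUnity K using (kpow≡^; ^-root; *-root)
  private
    module G = AbelianGroup G

  weightedSum : ZĜ K G → List ℤ → ℤ
  weightedSum ((k , _) ∷ ψ) (v ∷ vs) = k ℤ.* v ℤ.+ weightedSum ψ vs
  weightedSum _ _ = + 0

  toℚᵘ-thetaCoeff : ∀ ψ vs m → ℚ.toℚᵘ (thetaCoeff K G ψ vs m) ℚᵘ.≃ mkℚᵘ (weightedSum ψ vs) m
  toℚᵘ-thetaCoeff [] vs m = *≡* ≡.refl
  toℚᵘ-thetaCoeff (_ ∷ _) [] m = *≡* ≡.refl
  toℚᵘ-thetaCoeff ((k , _) ∷ ψ) (v ∷ vs) m = begin
    ℚ.toℚᵘ ((k ℚ./ 1) ℚ.* (v ℚ./ suc m) ℚ.+ thetaCoeff K G ψ vs m)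
      ≈⟨ ℚP.toℚᵘ-homo-+ ((k ℚ./ 1) ℚ.* (v ℚ./ suc m)) (thetaCoeff K G ψ vs m) ⟩
    ℚ.toℚᵘ ((k ℚ./ 1) ℚ.* (v ℚ./ suc m)) ℚᵘ.+ ℚ.toℚᵘ (thetaCoeff K G ψ vs m)
      ≈⟨ ℚᵘP.+-cong (ℚᵘP.≃-trans (ℚP.toℚᵘ-homo-* (k ℚ./ 1) (v ℚ./ suc m))
                                   (ℚᵘP.*-cong (ℚP.toℚᵘ-fromℚᵘ (mkℚᵘ k 0)) (ℚP.toℚᵘ-fromℚᵘ (mkℚᵘ v m))))
                    (toℚᵘ-thetaCoeff ψ vs m) ⟩
    mkℚᵘ k 0 ℚᵘ.* mkℚᵘ v m ℚᵘ.+ mkℚᵘ (weightedSum ψ vs) m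
      ≈⟨ ℚᵘP.+-cong (mkℚᵘ-* k v m) (ℚᵘP.≃-refl {mkℚᵘ (weightedSum ψ vs) m}) ⟩
    mkℚᵘ (k ℤ.* v) m ℚᵘ.+ mkℚᵘ (weightedSum ψ vs) m
      ≈⟨ mkℚᵘ-+ (k ℤ.* v) (weightedSum ψ vs) m ⟩
    mkℚᵘ (k ℤ.* v ℤ.+ weightedSum ψ vs) m ∎
    where open import Relation.Binary.Reasoning.Setoid ℚᵘP.≃-setoid

  thetaCoeff≡ : ∀ ψ vs m → thetaCoeff K G ψ vs m ≡ weightedSum ψ vs ℚ./ suc m
  thetaCoeff≡ ψ vs m = ≡.trans (≡.sym (ℚP.fromℚᵘ-toℚᵘ _)) (ℚP.fromℚᵘ-cong (toℚᵘ-thetaCoeff ψ vs m))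

  thetaCoeff-integral⇔∣ : ∀ ψ vs m →
    (IsIntegerℚ K G (thetaCoeff K G ψ vs m) ⇔ + suc m ℤ∣.∣ weightedSum ψ vs)
  thetaCoeff-integral⇔∣ ψ vs m = ≡.subst (λ q → ℚ.↧ₙ q ≡ 1 ⇔ + suc m ℤ∣.∣ weightedSum ψ vs)
    (≡.sym (thetaCoeff≡ ψ vs m)) (/-denominator≡1⇔∣ (weightedSum ψ vs) m)

  χ-gpow : ∀ (ch : Character K G) g n → Character.χ ch (gpow G g n) ≈ Character.χ ch g ^ n
  χ-gpow ch g zero = Character.unit ch
  χ-gpow ch g (suc n) = trans (Character.hom ch g _) (*-congˡ (χ-gpow ch g n))

  χ-root : ∀ (ch : Character K G) {g n} → gpow G g n G.≈ G.ε → Character.χ ch g ^ n ≈ 1#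
  χ-root ch {g} {n} gⁿ≈ε = trans (sym (χ-gpow ch g n)) (trans (Character.cong ch gⁿ≈ε) (Character.unit ch))

  kpow-root : ∀ {x n} k → x ^ n ≈ 1# → kpow K x k ^ n ≈ 1#
  kpow-root {x} {n} k xⁿ≈1 = trans (^-congˡ n (reflexive (kpow≡^ x k))) (^-root {x} {n} k xⁿ≈1)

  posPart-root : ∀ ψ {g n} → gpow G g n G.≈ G.ε → posPart K G ψ g ^ n ≈ 1#
  posPart-root [] {n = n} _ = ε^ n
  posPart-root ((+ k , ch) ∷ ψ) {g} {n} gⁿ≈ε =
    *-root {n = n} (kpow-root {Character.χ ch g} {n} k (χ-root ch {g} {n} gⁿ≈ε))
                   (posPart-root ψ {g} {n} gⁿ≈ε)
  posPart-root ((-[1+ k ] , ch) ∷ ψ) {g} {n} gⁿ≈ε = posPart-root ψ {g} {n} gⁿ≈ε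

  negPart-root : ∀ ψ {g n} → gpow G g n G.≈ G.ε → negPart K G ψ g ^ n ≈ 1#
  negPart-root [] {n = n} _ = ε^ n
  negPart-root ((+ k , ch) ∷ ψ) {g} {n} gⁿ≈ε = negPart-root ψ {g} {n} gⁿ≈ε
  negPart-root ((-[1+ k ] , ch) ∷ ψ) {g} {n} gⁿ≈ε =
    *-root {n = n} (kpow-root {Character.χ ch g} {n} (suc k) (χ-root ch {g} {n} gⁿ≈ε))
                   (negPart-root ψ {g} {n} gⁿ≈ε)

  module _ {ζ : ℕ → Carrier} {m} (z-order : HasOrder (ζ (suc m)) (suc m)) where
    private
      n : ℕ
      n = suc m
      z : Carrier
      z = ζ n
      zⁿ≈1 : z ^ n ≈ 1#
      zⁿ≈1 = proj₁ (proj₂ z-order)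
    open import Relation.Binary.Reasoning.Setoid setoid

    ZPowEq⇒≈^ : ∀ {x} v → ZPowEq K G x z v → ∃[ e ] (x ≈ z ^ e × + n ℤ∣.∣ + e ℤ.- v)
    ZPowEq⇒≈^ {x} (+ k) x≈zᵏ = k , trans x≈zᵏ (reflexive (kpow≡^ z k)) ,
      ℤ∣.divides (+ 0) (ℤP.+-inverseʳ (+ k))
    ZPowEq⇒≈^ {x} -[1+ k ] xzᵏ≈1 = m ℕ.* suc k , x≈zᵉ , ℤ∣.divides (+ suc k) e+k≡k*n
      where
      x≈zᵉ : x ≈ z ^ (m ℕ.* suc k)
      x≈zᵉ = begin
        x                                           ≈⟨ *-identityʳ x ⟨
        x * 1#                                      ≈⟨ *-congˡ (∣⇒^≈ε {z} {n} zⁿ≈1 (ℕ∣.m∣m*n (suc k))) ⟨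
        x * z ^ (suc k ℕ.+ m ℕ.* suc k)             ≈⟨ *-congˡ (^-homo-* z (suc k) (m ℕ.* suc k)) ⟩
        x * (z ^ suc k * z ^ (m ℕ.* suc k))         ≈⟨ *-assoc x _ _ ⟨
        (x * z ^ suc k) * z ^ (m ℕ.* suc k)         ≈⟨ *-congʳ (≡.subst (λ y → x * y ≈ 1#) (kpow≡^ z (suc k)) xzᵏ≈1) ⟩
        1# * z ^ (m ℕ.* suc k)                      ≈⟨ *-identityˡ _ ⟩
        z ^ (m ℕ.* suc k)                           ∎
      e+k≡k*n : + (m ℕ.* suc k) ℤ.- -[1+ k ] ≡ + suc k ℤ.* + n
      e+k≡k*n = ≡.trans (≡.sym (ℤP.pos-+ (m ℕ.* suc k) (suc k)))
        (≡.trans (≡.cong +_ (regroup m k)) (ℤP.pos-* (suc k) n))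
        where
        regroup : ∀ m k → m ℕ.* suc k ℕ.+ suc k ≡ suc k ℕ.* suc m
        regroup = NatSolver.solve-∀

    kpow-of-power : ∀ {x e} k → x ≈ z ^ e → kpow K x k ≈ z ^ (e ℕ.* k)
    kpow-of-power {x} {e} k x≈zᵉ =
      trans (reflexive (kpow≡^ x k)) (trans (^-congˡ k x≈zᵉ) (^-assocʳ z e k))

    *-of-powers : ∀ {x y p q} → x ≈ z ^ p → y ≈ z ^ q → x * y ≈ z ^ (p ℕ.+ q)
    *-of-powers {p = p} {q} x≈zᵖ y≈zᵠ = trans (*-cong x≈zᵖ y≈zᵠ) (sym (^-homo-* z p q))

    parts-as-powers : ∀ {s} ψ vs → Upsilons K G ζ ψ s n vs →
      ∃₂ λ P Q → posPart K G ψ s ≈ z ^ P × negPart K G ψ s ≈ z ^ Q ×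
                 + n ℤ∣.∣ (+ P ℤ.- + Q) ℤ.- weightedSum ψ vs
    parts-as-powers [] [] _ = 0 , 0 , refl , refl , ℤ∣.divides (+ 0) ≡.refl
    parts-as-powers [] (_ ∷ _) (lift ())
    parts-as-powers (_ ∷ _) [] (lift ())
    parts-as-powers ((+ k , ch) ∷ ψ) (v ∷ vs) ((_ , _ , χ≈) , ups)
      with ZPowEq⇒≈^ v χ≈ | parts-as-powers ψ vs ups
    ... | e , χ≈zᵉ , n∣e-v | P , Q , pos≈zᴾ , neg≈zᵠ , n∣D =
      e ℕ.* k ℕ.+ P , Q , *-of-powers {p = e ℕ.* k} (kpow-of-power {e = e} k χ≈zᵉ) pos≈zᴾ , neg≈zᵠ ,
      ≡.subst (+ n ℤ∣.∣_) (≡.sym difference) (ℤ∣.∣m∣n⇒∣m+n (ℤ∣.∣n⇒∣m*n (+ k) n∣e-v) n∣D)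
      where
      rearrange : ∀ e k P Q v S →
        (e ℤ.* k ℤ.+ P ℤ.- Q) ℤ.- (k ℤ.* v ℤ.+ S) ≡ k ℤ.* (e ℤ.- v) ℤ.+ ((P ℤ.- Q) ℤ.- S)
      rearrange = solve-∀
      difference : (+ (e ℕ.* k ℕ.+ P) ℤ.- + Q) ℤ.- (+ k ℤ.* v ℤ.+ weightedSum ψ vs)
                 ≡ + k ℤ.* (+ e ℤ.- v) ℤ.+ ((+ P ℤ.- + Q) ℤ.- weightedSum ψ vs)
      difference = ≡.trans (≡.cong (λ t → (t ℤ.- + Q) ℤ.- (+ k ℤ.* v ℤ.+ weightedSum ψ vs)) (pos-*-+ e k P))
        (rearrange (+ e) (+ k) (+ P) (+ Q) v (weightedSum ψ vs))
    parts-as-powers ((-[1+ k ] , ch) ∷ ψ) (v ∷ vs) ((_ , _ , χ≈) , ups)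
      with ZPowEq⇒≈^ v χ≈ | parts-as-powers ψ vs ups
    ... | e , χ≈zᵉ , n∣e-v | P , Q , pos≈zᴾ , neg≈zᵠ , n∣D =
      P , e ℕ.* suc k ℕ.+ Q , pos≈zᴾ , *-of-powers {p = e ℕ.* suc k} (kpow-of-power {e = e} (suc k) χ≈zᵉ) neg≈zᵠ ,
      ≡.subst (+ n ℤ∣.∣_) (≡.sym difference) (ℤ∣.∣m∣n⇒∣m-n n∣D (ℤ∣.∣n⇒∣m*n (+ suc k) n∣e-v))
      where
      rearrange : ∀ e k P Q v S →
        (P ℤ.- (e ℤ.* k ℤ.+ Q)) ℤ.- (ℤ.- k ℤ.* v ℤ.+ S) ≡ ((P ℤ.- Q) ℤ.- S) ℤ.- k ℤ.* (e ℤ.- v)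
      rearrange = solve-∀
      difference : (+ P ℤ.- + (e ℕ.* suc k ℕ.+ Q)) ℤ.- (-[1+ k ] ℤ.* v ℤ.+ weightedSum ψ vs)
                 ≡ ((+ P ℤ.- + Q) ℤ.- weightedSum ψ vs) ℤ.- + suc k ℤ.* (+ e ℤ.- v)
      difference = ≡.trans
        (≡.cong (λ t → (+ P ℤ.- t) ℤ.- (-[1+ k ] ℤ.* v ℤ.+ weightedSum ψ vs)) (pos-*-+ e (suc k) Q))
        (rearrange (+ e) (+ suc k) (+ P) (+ Q) v (weightedSum ψ vs))

    posPart≈negPart⇔∣ : ∀ {s} ψ vs → Upsilons K G ζ ψ s n vs →
      (posPart K G ψ s ≈ negPart K G ψ s ⇔ + n ℤ∣.∣ weightedSum ψ vs)
    posPart≈negPart⇔∣ ψ vs ups with parts-as-powers ψ vs ups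
    ... | P , Q , pos≈zᴾ , neg≈zᵠ , n∣D =
      ∣-difference⇒∣⇔∣ n∣D ⇔-∘ (^≈^⇔∣ z-order P Q ⇔-∘ mk⇔
        (λ pos≈neg → trans (sym pos≈zᴾ) (trans pos≈neg neg≈zᵠ))
        (λ zᴾ≈zᵠ → trans pos≈zᴾ (trans zᴾ≈zᵠ (sym neg≈zᵠ))))

  module _ {z : Carrier} {j : ℕ} (zⁿ≈1 : z ^ suc (2 ℕ.* j) ≈ 1#) where
    private
      n : ℕ
      n = suc (2 ℕ.* j)
    open import Relation.Binary.Reasoning.Setoid setoid

    ZPowEq-neg : ∀ {x} t → x * z ^ t ≈ 1# → ZPowEq K G x z (ℤ.- + t)
    ZPowEq-neg {x} zero xz⁰≈1 = trans (sym (*-identityʳ x)) xz⁰≈1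
    ZPowEq-neg (suc t) xzᵗ≈1 = trans (*-congˡ (reflexive (kpow≡^ z (suc t)))) xzᵗ≈1

    centred-exponent : ∀ {x} t → t < n → x * z ^ t ≈ 1# → ∃[ v ] Centred n v × ZPowEq K G x z v
    centred-exponent {x} t t<n xzᵗ≈1 with t ℕ.≤? j
    ... | yes t≤j = ℤ.- + t , Centred-- t≤j , ZPowEq-neg t xzᵗ≈1
    ... | no t≰j = + u , Centred-+ u≤j , x≈zᵘ
      where
      u : ℕ
      u = n ∸ t
      u≤j : u ≤ j
      u≤j = ℕP.≤-trans (ℕP.∸-monoʳ-≤ n (ℕP.≰⇒> t≰j))
        (ℕP.≤-reflexive (≡.trans (ℕP.m+n∸m≡n j (j ℕ.+ 0)) (ℕP.+-identityʳ j)))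
      x≈zᵘ : x ≈ kpow K z u
      x≈zᵘ = begin
        x                  ≈⟨ *-identityʳ x ⟨
        x * 1#             ≈⟨ *-congˡ zⁿ≈1 ⟨
        x * z ^ n          ≡⟨ ≡.cong (λ e → x * z ^ e) (ℕP.m+[n∸m]≡n (ℕP.<⇒≤ t<n)) ⟨
        x * z ^ (t ℕ.+ u)  ≈⟨ *-congˡ (^-homo-* z t u) ⟩
        x * (z ^ t * z ^ u) ≈⟨ *-assoc x _ _ ⟨
        (x * z ^ t) * z ^ u ≈⟨ *-congʳ xzᵗ≈1 ⟩
        1# * z ^ u          ≈⟨ *-identityˡ _ ⟩
        z ^ u               ≡⟨ kpow≡^ z u ⟨
        kpow K z u          ∎

module ThetaIntegrality {c ℓ a b} (K : CommutativeRing c ℓ) (isField : IsField K) (char0 : CharZero K)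
    (ζ : ℕ → CommutativeRing.Carrier K) (prim : PrimitiveRoots K ζ) (G : AbelianGroup a b) where
  open CommutativeRing K hiding (zero)
  open MonoidOrder *-monoid using (HasOrder)
  open RootsOfUnity K using (kpow≡^; module Orthogonality)
  open Theta K G
  private
    module G = AbelianGroup G

  primitive-order : ∀ m → HasOrder (ζ (suc m)) (suc m)
  primitive-order m =
    ℕ.z<s , ≡.subst (_≈ 1#) (kpow≡^ (ζ (suc m)) (suc m)) (proj₁ (prim (suc m) ℕ.z<s)) ,
    λ j 0<j j<n ζʲ≈1 →
      proj₂ (prim (suc m) ℕ.z<s) j 0<j j<n (≡.subst (_≈ 1#) (≡.sym (kpow≡^ _ j)) ζʲ≈1)

  integral⇔InA-at : ∀ ψ {s m} vs → Upsilons K G ζ ψ s (suc m) vs →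
    (IsIntegerℚ K G (thetaCoeff K G ψ vs m) ⇔ posPart K G ψ s ≈ negPart K G ψ s)
  integral⇔InA-at ψ {m = m} vs ups =
    ⇔-sym (posPart≈negPart⇔∣ (primitive-order m) ψ vs ups) ⇔-∘ thetaCoeff-integral⇔∣ ψ vs m

  module _ {g j} (g-order : IsOrder G g (suc (2 ℕ.* j))) where
    private
      n : ℕ
      n = suc (2 ℕ.* j)
      gⁿ≈ε : gpow G g n G.≈ G.ε
      gⁿ≈ε = proj₁ (proj₂ g-order)
      ζₙ-order : HasOrder (ζ n) n
      ζₙ-order = primitive-order (2 ℕ.* j)
    open Orthogonality isField char0 ζₙ-order using (¬¬-root; ¬¬-stable-≈)

    ¬¬-upsilons : ∀ ψ → ¬ ¬ (∃[ vs ] Upsilons K G ζ ψ g n vs)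
    ¬¬-upsilons [] none = none ([] , lift tt)
    ¬¬-upsilons ((k , ch) ∷ ψ) none = ¬¬-root (χ-root ch {g} {n} gⁿ≈ε) λ { (t , χζᵗ≈1) →
      let v , (lo , hi) , χ≈ζᵛ =
            centred-exponent {j = j} (proj₁ (proj₂ ζₙ-order)) (toℕ t) (FinP.toℕ<n t) χζᵗ≈1
      in ¬¬-upsilons ψ λ { (vs , ups) → none (v ∷ vs , (lo , hi , χ≈ζᵛ) , ups) } }

    ThetaIntegral⇒InA-at : ∀ ψ → ThetaIntegral K G ζ ψ → posPart K G ψ g ≈ negPart K G ψ g
    ThetaIntegral⇒InA-at ψ θ = ¬¬-stable-≈ (posPart-root ψ {g} {n} gⁿ≈ε) (negPart-root ψ {g} {n} gⁿ≈ε)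
      (λ pos≉neg → ¬¬-upsilons ψ λ { (vs , ups) →
        pos≉neg (Equivalence.to (integral⇔InA-at ψ vs ups) (θ g (2 ℕ.* j) g-order vs ups)) })

open import Data.Nat using (_*_; _+_)

proposition7p2 : ∀ {c ℓ a b : Level}
    (K : CommutativeRing c ℓ) → IsField K → CharZero K → AlgClosed K →
    (ζ : ℕ → CommutativeRing.Carrier K) → PrimitiveRoots K ζ →
    (G : AbelianGroup a b) →
    (es : List (AbelianGroup.Carrier G)) → Enumerates G es →
    ∃ (λ k → length es ≡ 2 * k + 1) →
    (ψ : ZĜ K G) →
    ThetaIntegral K G ζ ψ ⇔ InA K G ψ
proposition7p2 K isField char0 _ ζ prim G es enum (k , |G|≡2k+1) ψ = mk⇔
  (λ θ g → let j , g-order = odd-order {k} |G|≡odd g in ThetaIntegral⇒InA-at {g} {j} g-order ψ θ)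
  (λ inA s m _ vs ups → Equivalence.from (integral⇔InA-at ψ vs ups) (inA s))
  where
  open ThetaIntegrality K isField char0 ζ prim G
  open FiniteAbelianGroup G enum using (odd-order)
  |G|≡odd : length es ≡ suc (2 ℕ.* k)
  |G|≡odd = ≡.trans |G|≡2k+1 (ℕP.+-comm (2 ℕ.* k) 1)
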